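{- For every positive integer $n$ and every $S\subseteq\mathcal{H}=\{H^1,H^2,H^3\}$, \[H_n(C_4,S \setminus \{H^3\})\leq H_n(C_4,S)\leq 3^n H_n(C_4,S \setminus \{H^3\}).\]
   Context: Let $P,Q$ be two Hamiltonian paths of the complete graph $K_n$ and let $C$ be a cycle of length $4$ contained in the union of their edge sets, with each edge of $C$ attributed to a path containing it. Since a path contains no cycle, the edges of $C$ are split between the two paths, and there are essentially three ways this can happen, named by the longest run of consecutive edges of $C$ coming from a single path: $H^1$ (each path contributes two non-adjacent edges of $C$, i.e. the edges alternate), $H^2$ (each path contributes two adjacent edges of $C$), $H^3$ (one path contributes three consecutive edges of $C$ and the other the remaining edge). Let $\mathcal{H}=\{H^1,H^2,H^3\}$. For $S\subseteq\mathcal{H}$, $H_n(C_4,S)$ denotes the maximum number of Hamiltonian paths of $K_n$ such that for every pair of them there is a $4$-cycle in their union formed in one of the ways belonging to $S$. -}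

module Defs where

open import Data.Nat using (ℕ; suc; _≤_)
open import Data.Fin using (Fin; toℕ)
open import Data.Bool using (Bool; true; false)
open import Data.Maybe using (Maybe; just; nothing)
open import Data.List using (List; length)
open import Data.List.Relation.Unary.AllPairs using (AllPairs)
open import Data.Product using (Σ; _×_; ∃)
open import Data.Sum using (_⊎_)
open import Relation.Nullary using (¬_)
open import Relation.Binary.PropositionalEquality using (_≡_; _≢_)
open import Function.Definitions using (Injective)
open import Function.Bundles using (_⇔_)

-- A Hamiltonian path of K_n on vertex set Fin n: an ordering of all
-- vertices, i.e. an injective (hence bijective) map position ↦ vertex.
record HamPath (n : ℕ) : Set where
  constructor hampath
  field
    seq : Fin n → Fin n
    inj : Injective _≡_ _≡_ seq
open HamPath public

Edge : ∀ {n} → HamPath n → Fin n → Fin n → Set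
Edge P u v = Σ (Fin _) λ i → Σ (Fin _) λ j → (toℕ j ≡ suc (toℕ i)) ×
  ((seq P i ≡ u × seq P j ≡ v) ⊎ (seq P i ≡ v × seq P j ≡ u))

-- Paths are identified with their edge sets.
SamePath : ∀ {n} → HamPath n → HamPath n → Set
SamePath P Q = ∀ u v → Edge P u v ⇔ Edge Q u v

data Pat : Set where
  H1 H2 H3 : Pat

PatSet : Set
PatSet = Pat → Bool

withoutH3 : PatSet → PatSet
withoutH3 S H1 = S H1
withoutH3 S H2 = S H2
withoutH3 S H3 = false

-- Attribution labels for the edges ab, bc, cd, da of the 4-cycle abcd
-- (true = attributed to the first path, false = to the second path),
-- classified by the longest cyclic run of consecutive edges from one path.
-- Labelings with all four edges from one path give nothing (impossible anyway).
kind : Bool → Bool → Bool → Bool → Maybe Pat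
kind true  false true  false = just H1
kind false true  false true  = just H1
kind true  true  false false = just H2
kind false true  true  false = just H2
kind false false true  true  = just H2
kind true  false false true  = just H2
kind true  true  true  false = just H3
kind true  true  false true  = just H3
kind true  false true  true  = just H3
kind false true  true  true  = just H3
kind false false false true  = just H3
kind false false true  false = just H3
kind false true  false false = just H3
kind true  false false false = just H3
kind true  true  true  true  = nothing
kind false false false false = nothing

Attr : ∀ {n} → HamPath n → HamPath n → Bool → Fin n → Fin n → Set
Attr P Q true  u v = Edge P u v
Attr P Q false u v = Edge Q u v

GoodPair : ∀ {n} → PatSet → HamPath n → HamPath n → Set
GoodPair {n} S P Q =
  Σ (Fin n) λ a → Σ (Fin n) λ b → Σ (Fin n) λ c → Σ (Fin n) λ d →
  (a ≢ b) × (a ≢ c) × (a ≢ d) × (b ≢ c) × (b ≢ d) × (c ≢ d) ×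
  (Σ Bool λ l₁ → Σ Bool λ l₂ → Σ Bool λ l₃ → Σ Bool λ l₄ →
    Attr P Q l₁ a b × Attr P Q l₂ b c × Attr P Q l₃ c d × Attr P Q l₄ d a ×
    (Σ Pat λ p → (kind l₁ l₂ l₃ l₄ ≡ just p) × (S p ≡ true)))

ValidFamily : ∀ {n} → PatSet → List (HamPath n) → Set
ValidFamily S F = AllPairs (λ P Q → ¬ SamePath P Q × GoodPair S P Q) F

IsHn : (n : ℕ) → PatSet → ℕ → Set
IsHn n S m =
  (Σ (List (HamPath n)) λ F → ValidFamily S F × (length F ≡ m)) ×
  (∀ (F : List (HamPath n)) → ValidFamily S F → length F ≤ m)

module Submission where

-- The lower bound is monotonicity: a family that is good for S ∖ {H³} is good
-- for S.  For the upper bound colour every vertex by its position on a path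
-- modulo 3.  Along three consecutive edges of a path the position moves by
-- exactly ±3, so the two ends get the same colour, whereas the two ends of a
-- single edge never do.  Hence two paths inducing the same colouring can never
-- form a 4-cycle in the way H³.  Splitting an S-family into the 3ⁿ classes of
-- equal colouring, each class is an (S ∖ {H³})-family, which gives the factor 3ⁿ.

open import Defs
open import Level using (0ℓ)
open import Data.Nat using (ℕ; zero; suc; _≤_; _*_; _^_; _+_; z≤n; s≤s)
open import Data.Nat.Properties using (≤-pred; ≤∧≢⇒<; +-suc; +-mono-≤; module ≤-Reasoning)
import Data.Nat as ℕ
open import Data.Fin using (Fin; zero; suc; toℕ)
import Data.Fin.Properties as Fin
open import Data.Bool using (Bool; true; false)
import Data.Bool as Bool
open import Data.Maybe using (Maybe; just; nothing)
open import Data.Product using (Σ; _×_; _,_; uncurry)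
open import Data.Sum using (inj₁; inj₂)
open import Data.List using (List; []; _∷_; length; map; filter; tabulate; lookup; allFin; cartesianProduct; _++_)
open import Data.List.Properties using (length-map; length-++; length-tabulate; tabulate-lookup)
open import Data.List.Relation.Unary.All using (All; []; _∷_)
import Data.List.Relation.Unary.All as All
import Data.List.Relation.Unary.All.Properties as All
open import Data.List.Relation.Unary.Any using (Any; here; there)
import Data.List.Relation.Unary.Any as Any
import Data.List.Relation.Unary.Any.Properties as Any
open import Data.List.Relation.Unary.AllPairs using (AllPairs; []; _∷_)
import Data.List.Relation.Unary.AllPairs as AllPairs
import Data.List.Relation.Unary.AllPairs.Properties as AllPairs
open import Data.List.Membership.Propositional.Properties using (∈-allFin)
import Data.Vec.Functional as Vector
open import Data.Vec.Functional.Relation.Binary.Pointwise.Properties using (decSetoid)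
open import Relation.Nullary using (¬_; Dec; yes; no; contradiction)
open import Relation.Nullary.Decidable using (_×-dec_; _⊎-dec_; _→-dec_; ¬?; map′)
open import Relation.Unary.Properties using (∁?)
open import Relation.Binary.Bundles using (DecSetoid)
open import Relation.Binary.PropositionalEquality using (_≡_; _≢_; refl; sym; trans; cong; cong₂; subst; module ≡-Reasoning)
open import Function using (_∘_)
open import Function.Bundles using (_⇔_; mk⇔; Equivalence)
open import Function.Definitions using (Injective)
open import Function.Construct.Symmetry using (⇔-sym)
open import Function.Construct.Composition using (_⇔-∘_)

length-filter-split : {A : Set} {P : A → Set} (P? : ∀ x → Dec (P x)) (xs : List A) →
  length xs ≡ length (filter P? xs) + length (filter (∁? P?) xs)
length-filter-split P? [] = refl
length-filter-split P? (x ∷ xs) with P? x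
... | yes _ = cong suc (length-filter-split P? xs)
... | no _  = trans (cong suc (length-filter-split P? xs)) (sym (+-suc _ _))

module Pigeonhole (C : DecSetoid 0ℓ 0ℓ) where
  open DecSetoid C using (_≈_; _≟_) renaming (Carrier to Colour)
  module C = DecSetoid C

  monochrome : {A : Set} {R : A → A → Set} {colour : A → Colour} {c : Colour} {xs : List A} →
    AllPairs R xs → All (λ x → colour x ≈ c) xs →
    AllPairs (λ x y → R x y × colour x ≈ colour y) xs
  monochrome [] [] = []
  monochrome (rs ∷ rss) (p ∷ ps) =
    All.zipWith (λ (r , q) → r , C.trans p (C.sym q)) (rs , ps) ∷ monochrome rss ps

  pigeonhole : {A : Set} (R : A → A → Set) (colour : A → Colour) (m : ℕ) →
    (∀ G → AllPairs (λ x y → R x y × colour x ≈ colour y) G → length G ≤ m) →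
    (cs : List Colour) (F : List A) →
    All (λ x → Any (colour x ≈_) cs) F → AllPairs R F → length F ≤ length cs * m
  pigeonhole R colour m classBound [] [] _ _ = z≤n
  pigeonhole R colour m classBound [] (x ∷ F) (() ∷ _) _
  pigeonhole R colour m classBound (c ∷ cs) F covered pairwise = begin
    length F
      ≡⟨ length-filter-split inClass? F ⟩
    length (filter inClass? F) + length (filter (∁? inClass?) F)
      ≤⟨ +-mono-≤ (classBound _ (monochrome (AllPairs.filter⁺ inClass? pairwise) (All.all-filter inClass? F)))
                  (pigeonhole R colour m classBound cs _ othersCovered (AllPairs.filter⁺ (∁? inClass?) pairwise)) ⟩
    m + length cs * m ∎
    where
    open ≤-Reasoning
    inClass? : ∀ x → Dec (colour x ≈ c)
    inClass? x = colour x ≟ c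
    othersCovered : All (λ x → Any (colour x ≈_) cs) (filter (∁? inClass?) F)
    othersCovered = All.map (λ { (here p , ¬p) → contradiction p ¬p ; (there q , _) → q })
      (All.zip (All.filter⁺ (∁? inClass?) covered , All.all-filter (∁? inClass?) F))

allFuns : {A : Set} → List A → (k : ℕ) → List (Fin k → A)
allFuns xs zero = (λ ()) ∷ []
allFuns xs (suc k) = map (uncurry Vector._∷_) (cartesianProduct xs (allFuns xs k))

length-cartesianProduct : {A B : Set} (xs : List A) (ys : List B) →
  length (cartesianProduct xs ys) ≡ length xs * length ys
length-cartesianProduct [] ys = refl
length-cartesianProduct (x ∷ xs) ys = begin
  length (map (x ,_) ys ++ cartesianProduct xs ys)
    ≡⟨ length-++ (map (x ,_) ys) ⟩
  length (map (x ,_) ys) + length (cartesianProduct xs ys)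
    ≡⟨ cong₂ _+_ (length-map (x ,_) ys) (length-cartesianProduct xs ys) ⟩
  length ys + length xs * length ys ∎
  where open ≡-Reasoning

length-allFuns : {A : Set} (xs : List A) (k : ℕ) → length (allFuns xs k) ≡ length xs ^ k
length-allFuns xs zero = refl
length-allFuns xs (suc k) = begin
  length (map (uncurry Vector._∷_) (cartesianProduct xs (allFuns xs k)))
    ≡⟨ length-map (uncurry Vector._∷_) (cartesianProduct xs (allFuns xs k)) ⟩
  length (cartesianProduct xs (allFuns xs k))
    ≡⟨ length-cartesianProduct xs (allFuns xs k) ⟩
  length xs * length (allFuns xs k)
    ≡⟨ cong (length xs *_) (length-allFuns xs k) ⟩
  length xs ^ suc k ∎
  where open ≡-Reasoning

allFuns-complete : {A B : Set} {R : B → A → Set} {xs : List A} {k : ℕ} (f : Fin k → B) →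
  (∀ i → Any (R (f i)) xs) → Any (λ g → ∀ i → R (f i) (g i)) (allFuns xs k)
allFuns-complete {k = zero} f _ = here (λ ())
allFuns-complete {R = R} {k = suc k} f covered =
  Any.map⁺ (Any.map (λ { (r₀ , rs) → λ { zero → r₀ ; (suc i) → rs i } })
    (Any.cartesianProduct⁺ (covered zero) (allFuns-complete {R = R} (f ∘ suc) (covered ∘ suc))))

colouring-pigeonhole : {A : Set} (R : A → A → Set) {n k : ℕ} (colour : A → Fin n → Fin k) (m : ℕ) →
  (∀ G → AllPairs (λ x y → R x y × (∀ i → colour x i ≡ colour y i)) G → length G ≤ m) →
  (F : List A) → AllPairs R F → length F ≤ k ^ n * m
colouring-pigeonhole R {n} {k} colour m classBound F pairwise =
  subst (λ c → length F ≤ c * m) (trans (length-allFuns (allFin k) n) (cong (_^ n) (length-tabulate {n = k} (λ i → i))))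
    (Pigeonhole.pigeonhole (decSetoid (Fin.≡-decSetoid k) n) R colour m classBound (allFuns (allFin k) n) F
      (All.universal (λ x → allFuns-complete {R = _≡_} (colour x) (λ i → ∈-allFin (colour x i))) F) pairwise)

maximum : (P : ℕ → Set) → (∀ k → Dec (P k)) → P 0 → (t : ℕ) → (∀ k → P k → k ≤ t) →
  Σ ℕ λ m → P m × (∀ k → P k → k ≤ m)
maximum P P? P0 t bounded with P? t
... | yes Pt = t , Pt , bounded
maximum P P? P0 zero bounded | no ¬P0 = contradiction P0 ¬P0
maximum P P? P0 (suc t) bounded | no ¬Pt =
  maximum P P? P0 t (λ k Pk → ≤-pred (≤∧≢⇒< (bounded k Pk) λ { refl → ¬Pt Pk }))

allPairs-tabulate-resp : {A : Set} {R _~_ : A → A → Set} →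
  (∀ {x y x′ y′} → x ~ x′ → y ~ y′ → R x y → R x′ y′) →
  {k : ℕ} {f g : Fin k → A} → (∀ i → f i ~ g i) → AllPairs R (tabulate f) → AllPairs R (tabulate g)
allPairs-tabulate-resp resp {zero} f~g [] = []
allPairs-tabulate-resp resp {suc k} f~g (r ∷ rs) =
  All.tabulate⁺ (λ i → resp (f~g zero) (f~g (suc i)) (All.tabulate⁻ r i))
    ∷ allPairs-tabulate-resp resp (f~g ∘ suc) rs

edge? : ∀ {n} (P : HamPath n) u v → Dec (Edge P u v)
edge? P u v = Fin.any? λ i → Fin.any? λ j → (toℕ j ℕ.≟ suc (toℕ i)) ×-dec
  ((seq P i Fin.≟ u ×-dec seq P j Fin.≟ v) ⊎-dec (seq P i Fin.≟ v ×-dec seq P j Fin.≟ u))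

samePath? : ∀ {n} (P Q : HamPath n) → Dec (SamePath P Q)
samePath? P Q = Fin.all? λ u → Fin.all? λ v →
  map′ (uncurry mk⇔) (λ e → Equivalence.to e , Equivalence.from e)
    ((edge? P u v →-dec edge? Q u v) ×-dec (edge? Q u v →-dec edge? P u v))

attr? : ∀ {n} (P Q : HamPath n) l u v → Dec (Attr P Q l u v)
attr? P Q true u v = edge? P u v
attr? P Q false u v = edge? Q u v

someBool? : {P : Bool → Set} → (∀ b → Dec (P b)) → Dec (Σ Bool P)
someBool? P? = map′ (λ { (inj₁ p) → true , p ; (inj₂ p) → false , p })
  (λ { (true , p) → inj₁ p ; (false , p) → inj₂ p }) (P? true ⊎-dec P? false)

patternIn? : (S : PatSet) (k : Maybe Pat) → Dec (Σ Pat λ p → (k ≡ just p) × (S p ≡ true))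
patternIn? S nothing = no λ ()
patternIn? S (just p) = map′ (λ s → p , refl , s) (λ { (_ , refl , s) → s }) (S p Bool.≟ true)

goodPair? : ∀ {n} S (P Q : HamPath n) → Dec (GoodPair S P Q)
goodPair? S P Q = Fin.any? λ a → Fin.any? λ b → Fin.any? λ c → Fin.any? λ d →
  ¬? (a Fin.≟ b) ×-dec ¬? (a Fin.≟ c) ×-dec ¬? (a Fin.≟ d) ×-dec ¬? (b Fin.≟ c) ×-dec
  ¬? (b Fin.≟ d) ×-dec ¬? (c Fin.≟ d) ×-dec
  (someBool? λ l₁ → someBool? λ l₂ → someBool? λ l₃ → someBool? λ l₄ →
    attr? P Q l₁ a b ×-dec attr? P Q l₂ b c ×-dec attr? P Q l₃ c d ×-dec attr? P Q l₄ d a ×-dec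
    patternIn? S (kind l₁ l₂ l₃ l₄))

Related : ∀ {n} → PatSet → HamPath n → HamPath n → Set
Related S P Q = ¬ SamePath P Q × GoodPair S P Q

validFamily? : ∀ {n} S (F : List (HamPath n)) → Dec (ValidFamily S F)
validFamily? S = AllPairs.allPairs? λ P Q → ¬? (samePath? P Q) ×-dec goodPair? S P Q

samePath-pointwise : ∀ {n} {P Q : HamPath n} → (∀ i → seq P i ≡ seq Q i) → SamePath P Q
samePath-pointwise {P = P} {Q} P≗Q u v = mk⇔ (transfer {P} {Q} P≗Q) (transfer {Q} {P} (sym ∘ P≗Q))
  where
  transfer : ∀ {X Y : HamPath _} → (∀ i → seq X i ≡ seq Y i) → Edge X u v → Edge Y u v
  transfer X≗Y (i , j , j≡1+i , inj₁ (xi≡u , xj≡v)) =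
    i , j , j≡1+i , inj₁ (trans (sym (X≗Y i)) xi≡u , trans (sym (X≗Y j)) xj≡v)
  transfer X≗Y (i , j , j≡1+i , inj₂ (xi≡v , xj≡u)) =
    i , j , j≡1+i , inj₂ (trans (sym (X≗Y i)) xi≡v , trans (sym (X≗Y j)) xj≡u)

goodPair-resp : ∀ {n} S {P P′ Q Q′ : HamPath n} →
  (∀ {u v} → Edge P u v → Edge P′ u v) → (∀ {u v} → Edge Q u v → Edge Q′ u v) →
  GoodPair S P Q → GoodPair S P′ Q′
goodPair-resp S {P} {P′} {Q} {Q′} P⊆P′ Q⊆Q′
  (a , b , c , d , a≢b , a≢c , a≢d , b≢c , b≢d , c≢d , l₁ , l₂ , l₃ , l₄ , e₁ , e₂ , e₃ , e₄ , inS) =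
  a , b , c , d , a≢b , a≢c , a≢d , b≢c , b≢d , c≢d , l₁ , l₂ , l₃ , l₄ , attr l₁ e₁ , attr l₂ e₂ , attr l₃ e₃ , attr l₄ e₄ , inS
  where
  attr : ∀ l {u v} → Attr P Q l u v → Attr P′ Q′ l u v
  attr true = P⊆P′
  attr false = Q⊆Q′

related-resp : ∀ {n} S {P P′ Q Q′ : HamPath n} → SamePath P P′ → SamePath Q Q′ → Related S P Q → Related S P′ Q′
related-resp S P~P′ Q~Q′ (distinct , good) =
  (λ P′~Q′ → distinct λ u v → ⇔-sym (Q~Q′ u v) ⇔-∘ (P′~Q′ u v ⇔-∘ P~P′ u v)) ,
  goodPair-resp S (Equivalence.to (P~P′ _ _)) (Equivalence.to (Q~Q′ _ _)) good

injective? : ∀ {n} (g : Fin n → Fin n) → Dec (Injective _≡_ _≡_ g)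
injective? g = map′ (λ h {x} {y} → h x y) (λ h x y → h)
  (Fin.all? λ x → Fin.all? λ y → (g x Fin.≟ g y) →-dec (x Fin.≟ y))

paths : ∀ {n} → List (Fin n → Fin n) → List (HamPath n)
paths [] = []
paths (g ∷ gs) with injective? g
... | yes g-inj = hampath g g-inj ∷ paths gs
... | no _ = paths gs

paths-complete : ∀ {n} {f : Fin n → Fin n} (gs : List (Fin n → Fin n)) → Injective _≡_ _≡_ f →
  Any (λ g → ∀ i → f i ≡ g i) gs → Any (λ Q → ∀ i → f i ≡ seq Q i) (paths gs)
paths-complete (g ∷ gs) f-inj (here f≗g) with injective? g
... | yes _ = here f≗g
... | no g-not-inj = contradiction (λ {x} {y} gx≡gy → f-inj (trans (f≗g x) (trans gx≡gy (sym (f≗g y))))) g-not-inj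
paths-complete (g ∷ gs) f-inj (there found) with injective? g
... | yes _ = there (paths-complete gs f-inj found)
... | no _ = paths-complete gs f-inj found

allPaths : (n : ℕ) → List (HamPath n)
allPaths n = paths (allFuns (allFin n) n)

allPaths-complete : ∀ {n} (P : HamPath n) → Any (SamePath P) (allPaths n)
allPaths-complete P = Any.map (λ {Q} → samePath-pointwise {P = P} {Q})
  (paths-complete _ (inj P) (allFuns-complete {R = _≡_} (seq P) (λ i → ∈-allFin (seq P i))))

Family : (n : ℕ) → PatSet → ℕ → Set
Family n S k = Σ (Fin k → HamPath n) λ g → ValidFamily S (tabulate g)

-- Replacing every member by its representative in allPaths n keeps a family
-- valid, so the finite search over allPaths n decides existence.
family? : ∀ n S k → Dec (Family n S k)
family? n S k with Any.any? (λ g → validFamily? S (tabulate g)) (allFuns (allPaths n) k)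
... | yes found = yes (Any.satisfied found)
... | no none = no λ (g , valid) → none
  (Any.map (λ g~h → allPairs-tabulate-resp (related-resp S) g~h valid)
    (allFuns-complete {R = SamePath} g (λ i → allPaths-complete (g i))))

-- Distinct members of a valid family have distinct vertex sequences, and there
-- are nⁿ sequences.
validFamily-bound : ∀ {n} S (F : List (HamPath n)) → ValidFamily S F → length F ≤ n ^ n * 1
validFamily-bound S F valid = colouring-pigeonhole (Related S) seq 1 atMostOne F valid
  where
  atMostOne : ∀ G → AllPairs (λ P Q → Related S P Q × (∀ i → seq P i ≡ seq Q i)) G → length G ≤ 1
  atMostOne [] _ = z≤n
  atMostOne (_ ∷ []) _ = s≤s z≤n
  atMostOne (P ∷ Q ∷ _) ((((distinct , _) , P≗Q) ∷ _) ∷ _) = contradiction (samePath-pointwise {P = P} {Q} P≗Q) distinct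

hn-exists : ∀ n S → Σ ℕ (IsHn n S)
hn-exists n S with maximum (Family n S) (family? n S) ((λ ()) , []) (n ^ n * 1)
                     (λ k (g , valid) → subst (_≤ n ^ n * 1) (length-tabulate g) (validFamily-bound S _ valid))
... | m , (g , valid) , largest =
  m , (tabulate g , valid , length-tabulate g) ,
  λ F valid′ → largest (length F) (lookup F , subst (ValidFamily S) (sym (tabulate-lookup F)) valid′)

-- The position of a vertex on P (defaulting to 0 for a vertex not found; only
-- vertices on P are used below).
position : ∀ {n} → HamPath n → Fin n → ℕ
position P v with Fin.any? (λ i → seq P i Fin.≟ v)
... | yes (i , _) = toℕ i
... | no _ = 0

position-seq : ∀ {n} (P : HamPath n) i → position P (seq P i) ≡ toℕ i
position-seq P i with Fin.any? (λ j → seq P j Fin.≟ seq P i)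
... | yes (j , Pj≡Pi) = cong toℕ (inj P Pj≡Pi)
... | no none = contradiction (i , refl) none

OnPath : ∀ {n} → HamPath n → Fin n → Set
OnPath P v = Σ (Fin _) λ i → seq P i ≡ v

position-injective : ∀ {n} (P : HamPath n) {u v} → OnPath P u → OnPath P v →
  position P u ≡ position P v → u ≡ v
position-injective P (i , refl) (j , refl) same =
  cong (seq P) (Fin.toℕ-injective (trans (sym (position-seq P i)) (trans same (position-seq P j))))

source : ∀ {n} (P : HamPath n) {u v} → Edge P u v → OnPath P u
source P (i , _ , _ , inj₁ (Pi≡u , _)) = i , Pi≡u
source P (_ , j , _ , inj₂ (_ , Pj≡u)) = j , Pj≡u

target : ∀ {n} (P : HamPath n) {u v} → Edge P u v → OnPath P v
target P (_ , j , _ , inj₁ (_ , Pj≡v)) = j , Pj≡v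
target P (i , _ , _ , inj₂ (Pi≡v , _)) = i , Pi≡v

data Adjacent : ℕ → ℕ → Set where
  up   : ∀ a → Adjacent a (suc a)
  down : ∀ a → Adjacent (suc a) a

edge-adjacent : ∀ {n} (P : HamPath n) {u v} → Edge P u v → Adjacent (position P u) (position P v)
edge-adjacent P (i , j , j≡1+i , inj₁ (refl , refl))
  rewrite position-seq P i | position-seq P j | j≡1+i = up (toℕ i)
edge-adjacent P (i , j , j≡1+i , inj₂ (refl , refl))
  rewrite position-seq P i | position-seq P j | j≡1+i = down (toℕ i)

next : Fin 3 → Fin 3
next zero = suc zero
next (suc zero) = suc (suc zero)
next (suc (suc zero)) = zero

next-≢ : ∀ x → next x ≢ x
next-≢ zero ()
next-≢ (suc zero) ()
next-≢ (suc (suc zero)) ()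

next³ : ∀ x → next (next (next x)) ≡ x
next³ zero = refl
next³ (suc zero) = refl
next³ (suc (suc zero)) = refl

mod3 : ℕ → Fin 3
mod3 zero = zero
mod3 (suc a) = next (mod3 a)

adjacent-mod3 : ∀ {a b} → Adjacent a b → mod3 a ≢ mod3 b
adjacent-mod3 (up a) e = next-≢ (mod3 a) (sym e)
adjacent-mod3 (down b) e = next-≢ (mod3 b) e

-- Three steps that never turn back move by ±3, preserving the residue.
three-steps-mod3 : ∀ {a b c d} → Adjacent a b → Adjacent b c → Adjacent c d → a ≢ c → b ≢ d →
  mod3 a ≡ mod3 d
three-steps-mod3 (up a) (up _) (up _) _ _ = sym (next³ (mod3 a))
three-steps-mod3 (down _) (down _) (down d) _ _ = next³ (mod3 d)
three-steps-mod3 (up _) (up _) (down _) _ b≢d = contradiction refl b≢d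
three-steps-mod3 (up _) (down _) _ a≢c _ = contradiction refl a≢c
three-steps-mod3 (down _) (up _) _ a≢c _ = contradiction refl a≢c
three-steps-mod3 (down _) (down _) (up _) _ b≢d = contradiction refl b≢d

colouring : ∀ {n} → HamPath n → Fin n → Fin 3
colouring P v = mod3 (position P v)

SameColouring : ∀ {n} → HamPath n → HamPath n → Set
SameColouring P Q = ∀ v → colouring P v ≡ colouring Q v

three-plus-one-impossible : ∀ {n} (X Y : HamPath n) → SameColouring X Y → ∀ {u w x v} →
  Edge X u w → Edge X w x → Edge X x v → u ≢ x → w ≢ v → ¬ Edge Y v u
three-plus-one-impossible X Y same e₁ e₂ e₃ u≢x w≢v e =
  adjacent-mod3 (edge-adjacent Y e) (begin
    colouring Y _ ≡⟨ sym (same _) ⟩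
    colouring X _ ≡⟨ sym (three-steps-mod3 (edge-adjacent X e₁) (edge-adjacent X e₂) (edge-adjacent X e₃)
                       (u≢x ∘ position-injective X (source X e₁) (target X e₂))
                       (w≢v ∘ position-injective X (target X e₁) (target X e₃))) ⟩
    colouring X _ ≡⟨ same _ ⟩
    colouring Y _ ∎)
  where open ≡-Reasoning

-- Hence two paths with the same colouring form no 4-cycle in the way H³: up to
-- rotation, one of them supplies three consecutive edges and the other the fourth.
no-H3-cycle : ∀ {n} (P Q : HamPath n) → SameColouring P Q → ∀ {a b c d} → a ≢ c → b ≢ d →
  ∀ l₁ l₂ l₃ l₄ → Attr P Q l₁ a b → Attr P Q l₂ b c → Attr P Q l₃ c d → Attr P Q l₄ d a →
  kind l₁ l₂ l₃ l₄ ≢ just H3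
no-H3-cycle P Q same a≢c b≢d true true true false e₁ e₂ e₃ e₄ _ =
  three-plus-one-impossible P Q same e₁ e₂ e₃ a≢c b≢d e₄
no-H3-cycle P Q same a≢c b≢d true true false true e₁ e₂ e₃ e₄ _ =
  three-plus-one-impossible P Q same e₄ e₁ e₂ (b≢d ∘ sym) a≢c e₃
no-H3-cycle P Q same a≢c b≢d true false true true e₁ e₂ e₃ e₄ _ =
  three-plus-one-impossible P Q same e₃ e₄ e₁ (a≢c ∘ sym) (b≢d ∘ sym) e₂
no-H3-cycle P Q same a≢c b≢d false true true true e₁ e₂ e₃ e₄ _ =
  three-plus-one-impossible P Q same e₂ e₃ e₄ b≢d (a≢c ∘ sym) e₁
no-H3-cycle P Q same a≢c b≢d false false false true e₁ e₂ e₃ e₄ _ =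
  three-plus-one-impossible Q P (sym ∘ same) e₁ e₂ e₃ a≢c b≢d e₄
no-H3-cycle P Q same a≢c b≢d false false true false e₁ e₂ e₃ e₄ _ =
  three-plus-one-impossible Q P (sym ∘ same) e₄ e₁ e₂ (b≢d ∘ sym) a≢c e₃
no-H3-cycle P Q same a≢c b≢d false true false false e₁ e₂ e₃ e₄ _ =
  three-plus-one-impossible Q P (sym ∘ same) e₃ e₄ e₁ (a≢c ∘ sym) (b≢d ∘ sym) e₂
no-H3-cycle P Q same a≢c b≢d true false false false e₁ e₂ e₃ e₄ _ =
  three-plus-one-impossible Q P (sym ∘ same) e₂ e₃ e₄ b≢d (a≢c ∘ sym) e₁
no-H3-cycle P Q same a≢c b≢d true false true false e₁ e₂ e₃ e₄ ()
no-H3-cycle P Q same a≢c b≢d false true false true e₁ e₂ e₃ e₄ ()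
no-H3-cycle P Q same a≢c b≢d true true false false e₁ e₂ e₃ e₄ ()
no-H3-cycle P Q same a≢c b≢d false true true false e₁ e₂ e₃ e₄ ()
no-H3-cycle P Q same a≢c b≢d false false true true e₁ e₂ e₃ e₄ ()
no-H3-cycle P Q same a≢c b≢d true false false true e₁ e₂ e₃ e₄ ()
no-H3-cycle P Q same a≢c b≢d true true true true e₁ e₂ e₃ e₄ ()
no-H3-cycle P Q same a≢c b≢d false false false false e₁ e₂ e₃ e₄ ()

withoutH3-keeps : ∀ S p → S p ≡ true → p ≢ H3 → withoutH3 S p ≡ true
withoutH3-keeps S H1 p∈S _ = p∈S
withoutH3-keeps S H2 p∈S _ = p∈S
withoutH3-keeps S H3 _ H3≢H3 = contradiction refl H3≢H3

withoutH3-⊆ : ∀ S p → withoutH3 S p ≡ true → S p ≡ true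
withoutH3-⊆ S H1 p∈S = p∈S
withoutH3-⊆ S H2 p∈S = p∈S
withoutH3-⊆ S H3 ()

goodPair-mono : ∀ {n} {S T : PatSet} {P Q : HamPath n} → (∀ p → S p ≡ true → T p ≡ true) →
  GoodPair S P Q → GoodPair T P Q
goodPair-mono S⊆T (a , b , c , d , a≢b , a≢c , a≢d , b≢c , b≢d , c≢d , l₁ , l₂ , l₃ , l₄ , e₁ , e₂ , e₃ , e₄ , p , kind≡p , p∈S) =
  a , b , c , d , a≢b , a≢c , a≢d , b≢c , b≢d , c≢d , l₁ , l₂ , l₃ , l₄ , e₁ , e₂ , e₃ , e₄ , p , kind≡p , S⊆T p p∈S

goodPair-withoutH3 : ∀ {n} S (P Q : HamPath n) → SameColouring P Q → GoodPair S P Q → GoodPair (withoutH3 S) P Q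
goodPair-withoutH3 S P Q same (a , b , c , d , a≢b , a≢c , a≢d , b≢c , b≢d , c≢d , l₁ , l₂ , l₃ , l₄ , e₁ , e₂ , e₃ , e₄ , p , kind≡p , p∈S) =
  a , b , c , d , a≢b , a≢c , a≢d , b≢c , b≢d , c≢d , l₁ , l₂ , l₃ , l₄ , e₁ , e₂ , e₃ , e₄ , p , kind≡p ,
  withoutH3-keeps S p p∈S (λ { refl → no-H3-cycle P Q same a≢c b≢d l₁ l₂ l₃ l₄ e₁ e₂ e₃ e₄ kind≡p })

validFamily-weaken : ∀ {n} S (F : List (HamPath n)) → ValidFamily (withoutH3 S) F → ValidFamily S F
validFamily-weaken S F = AllPairs.map λ (distinct , good) → distinct , goodPair-mono (withoutH3-⊆ S) good

-- Each colour class of a valid S-family is a valid (S ∖ {H³})-family, and there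
-- are 3ⁿ colourings.
validFamily-H3-bound : ∀ {n} S {m′} → IsHn n (withoutH3 S) m′ →
  (F : List (HamPath n)) → ValidFamily S F → length F ≤ 3 ^ n * m′
validFamily-H3-bound S {m′} (_ , largest) F valid =
  colouring-pigeonhole (Related S) colouring m′
    (λ G classValid → largest G (AllPairs.map (λ { {P} {Q} ((distinct , good) , same) →
      distinct , goodPair-withoutH3 S P Q same good }) classValid))
    F valid

hn-comparison : ∀ {n} S {m m′} → IsHn n S m → IsHn n (withoutH3 S) m′ → (m′ ≤ m) × (m ≤ 3 ^ n * m′)
hn-comparison {n} S {m} {m′} ((F , valid , |F|≡m) , largest) isHn′@((F′ , valid′ , |F′|≡m′) , _) =
  subst (_≤ m) |F′|≡m′ (largest F′ (validFamily-weaken S F′ valid′)) ,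
  subst (_≤ 3 ^ n * m′) |F|≡m (validFamily-H3-bound S isHn′ F valid)

-- Lemma 5.5.
lemma5p5 : (n : ℕ) → 1 ≤ n → (S : PatSet) →
    Σ ℕ λ m → Σ ℕ λ m' →
      IsHn n S m × IsHn n (withoutH3 S) m' × (m' ≤ m) × (m ≤ 3 ^ n * m')
lemma5p5 n _ S =
  let m , isHn = hn-exists n S
      m′ , isHn′ = hn-exists n (withoutH3 S)
  in m , m′ , isHn , isHn′ , hn-comparison S isHn isHn′
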